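{- Let $n$ be an integer with $n \geq 0$ and let $x$ be a real number (equivalently, an indeterminate). Then $$\sum_{0 \leq j \leq n} \binom{3n-j}{2n}(1-x)^{n-j} = \sum_{0 \leq j \leq n} \binom{3n+1}{n-j} x^j (1-x)^{n-j}$$ and $$\sum_{0 \leq j \leq 2n} \binom{3n-j}{n}(1-x)^{2n-j} = \sum_{0 \leq k \leq 2n} \binom{3n+1}{n+1+k} x^k (1-x)^{2n-k}.$$ -}

module Defs where

open import Level using (Level)
open import Data.Nat using (ℕ; zero; suc)
open import Algebra.Bundles using (CommutativeRing)

module _ {c ℓ : Level} (R : CommutativeRing c ℓ) where
  open CommutativeRing R using (Carrier; 0#; 1#; _+_; _*_)

  natR : ℕ → Carrier
  natR zero    = 0#
  natR (suc n) = 1# + natR n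

  powR : Carrier → ℕ → Carrier
  powR x zero    = 1#
  powR x (suc n) = x * powR x n

  -- sumR n f = f 0 + f 1 + ... + f n   (sum over 0 ≤ j ≤ n, inclusive)
  sumR : ℕ → (ℕ → Carrier) → Carrier
  sumR zero    f = f zero
  sumR (suc n) f = sumR n f + f (suc n)

module Submission where

-- Proof idea.  Fix a commutative ring and elements x, y with x + y = 1
-- (in the corollary y = 1 - x).  For natural numbers N and m let
--
--   T N m = Σ_{0 ≤ j ≤ m} C(N, m - j) x^j y^(m - j)
--
-- be the part of the binomial expansion of (x + y)^N of y-degree at most m.
-- Pascal's rule splits T (N+1) (m+1) into T N (m+1) + y T N m, and peeling off
-- the j = 0 term gives T N (m+1) = C(N, m+1) y^(m+1) + x T N m; since x + y = 1
-- this yields  T (N+1) (m+1) = C(N, m+1) y^(m+1) + T N m,  and induction on m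
-- gives the closed form
--
--   T (a + m + 1) m = Σ_{0 ≤ i ≤ m} C(a + i, i) y^i.                       (*)
--
-- Reversing the index j ↦ m - j turns both left-hand sides of the corollary
-- into the right-hand side of (*), with (a, m) = (2n, n) and (a, m) = (n, 2n);
-- the first right-hand side is then T (3n+1) n, and the second is T (3n+1) (2n)
-- after the symmetry C(N, k) = C(N, N - k).

open import Defs
open import Level using (Level)
open import Data.Product using (_×_; _,_)
open import Data.Nat using (ℕ; zero; suc; _+_; _*_; _∸_; _≤_; z≤n)
open import Data.Nat.Properties
  using (≤-refl; ≤-trans; m≤n⇒m≤1+n; m≤m+n; m≤n+m; m∸n≤m; n∸n≡0; m+n∸m≡n; m∸[m∸n]≡n; +-∸-assoc; +-suc)
import Data.Nat.Properties as ℕₚ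
open import Data.Nat.Combinatorics using (_C_; nCk≡nC[n∸k]; nCk+nC[k+1]≡[n+1]C[k+1])
open import Algebra.Bundles using (CommutativeRing)
open import Relation.Binary.PropositionalEquality as P using (_≡_)
import Relation.Binary.Reasoning.Setoid as SetoidReasoning
import Algebra.Properties.CommutativeSemigroup as CommSemigroupProperties
import Algebra.Properties.AbelianGroup as AbelianGroupProperties

+-∸-complement : ∀ a {m k} → k ≤ m → (a + m) ∸ (m ∸ k) ≡ a + k
+-∸-complement a {m} {k} k≤m =
  P.trans (+-∸-assoc a (m∸n≤m m k)) (P.cong (a +_) (m∸[m∸n]≡n k≤m))

choose-symmetric : ∀ a b → (a + b) C a ≡ (a + b) C b
choose-symmetric a b =
  P.trans (nCk≡nC[n∸k] (m≤m+n a b)) (P.cong ((a + b) C_) (m+n∸m≡n a b))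

choose-symmetric-∸ : ∀ a {m k} → k ≤ m → (a + m) C (m ∸ k) ≡ (a + m) C (a + k)
choose-symmetric-∸ a {m} {k} k≤m =
  P.trans (nCk≡nC[n∸k] (≤-trans (m∸n≤m m k) (m≤n+m m a))) (P.cong ((a + m) C_) (+-∸-complement a k≤m))

module Sums {c ℓ : Level} (R : CommutativeRing c ℓ) where
  open CommutativeRing R renaming (_+_ to _⊕_; _*_ to _⊗_)
  open SetoidReasoning setoid
  open CommSemigroupProperties +-commutativeSemigroup using (interchange)

  ∑ : ℕ → (ℕ → Carrier) → Carrier
  ∑ = sumR R

  natR-+ : ∀ a b → natR R (a + b) ≈ natR R a ⊕ natR R b
  natR-+ zero    b = sym (+-identityˡ _)
  natR-+ (suc a) b = trans (+-congˡ (natR-+ a b)) (sym (+-assoc _ _ _))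

  ∑-cong : ∀ m {f g : ℕ → Carrier} → (∀ j → j ≤ m → f j ≈ g j) → ∑ m f ≈ ∑ m g
  ∑-cong zero    f≈g = f≈g 0 z≤n
  ∑-cong (suc m) f≈g =
    +-cong (∑-cong m (λ j j≤m → f≈g j (m≤n⇒m≤1+n j≤m))) (f≈g (suc m) ≤-refl)

  ∑-+ : ∀ m (f g : ℕ → Carrier) → ∑ m (λ j → f j ⊕ g j) ≈ ∑ m f ⊕ ∑ m g
  ∑-+ zero    f g = refl
  ∑-+ (suc m) f g = trans (+-congʳ (∑-+ m f g)) (interchange _ _ _ _)

  ∑-*ˡ : ∀ m (a : Carrier) (f : ℕ → Carrier) → ∑ m (λ j → a ⊗ f j) ≈ a ⊗ ∑ m f
  ∑-*ˡ zero    a f = refl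
  ∑-*ˡ (suc m) a f = trans (+-congʳ (∑-*ˡ m a f)) (sym (distribˡ a _ _))

  ∑-first : ∀ m (f : ℕ → Carrier) → ∑ (suc m) f ≈ f 0 ⊕ ∑ m (λ j → f (suc j))
  ∑-first zero    f = refl
  ∑-first (suc m) f = trans (+-congʳ (∑-first m f)) (+-assoc _ _ _)

  ∑-reverse : ∀ m (f : ℕ → Carrier) → ∑ m f ≈ ∑ m (λ j → f (m ∸ j))
  ∑-reverse zero    f = refl
  ∑-reverse (suc m) f = begin
    ∑ (suc m) f                              ≈⟨ ∑-first m f ⟩
    f 0 ⊕ ∑ m (λ j → f (suc j))              ≈⟨ +-congˡ (∑-reverse m (λ j → f (suc j))) ⟩
    f 0 ⊕ ∑ m (λ j → f (suc (m ∸ j)))        ≈⟨ +-congˡ (∑-cong m (λ j j≤m →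
                                                  reflexive (P.cong f (P.sym (+-∸-assoc 1 j≤m))))) ⟩
    f 0 ⊕ ∑ m (λ j → f (suc m ∸ j))          ≈⟨ +-comm _ _ ⟩
    ∑ m (λ j → f (suc m ∸ j)) ⊕ f 0          ≈⟨ +-congˡ (reflexive (P.cong f (P.sym (n∸n≡0 m)))) ⟩
    ∑ m (λ j → f (suc m ∸ j)) ⊕ f (m ∸ m)    ∎

module BinomialSums {c ℓ : Level} (R : CommutativeRing c ℓ) where
  open CommutativeRing R renaming (_+_ to _⊕_; _*_ to _⊗_)
  open Sums R
  open SetoidReasoning setoid
  open CommSemigroupProperties *-commutativeSemigroup using (x∙yz≈y∙xz)
  open CommSemigroupProperties +-commutativeSemigroup using (xy∙z≈xz∙y)

  reindex : ∀ a m (z : Carrier) →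
    ∑ m (λ j → natR R (((a + m) ∸ j) C a) ⊗ powR R z (m ∸ j))
      ≈ ∑ m (λ i → natR R ((a + i) C i) ⊗ powR R z i)
  reindex a m z = trans (∑-reverse m _) (∑-cong m λ i i≤m →
    *-cong (reflexive (P.cong (natR R) (P.trans (P.cong (_C a) (+-∸-complement a i≤m))
                                                (choose-symmetric a i))))
           (reflexive (P.cong (powR R z) (m∸[m∸n]≡n i≤m))))

  module _ {x y : Carrier} (x+y≈1 : x ⊕ y ≈ 1#) where

    binom : ℕ → ℕ → Carrier
    binom N k = natR R (N C k)

    T : ℕ → ℕ → Carrier
    T N m = ∑ m (λ j → binom N (m ∸ j) ⊗ (powR R x j ⊗ powR R y (m ∸ j)))

    T-first : ∀ N m → T N (suc m) ≈ binom N (suc m) ⊗ powR R y (suc m) ⊕ x ⊗ T N m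
    T-first N m = begin
      T N (suc m)
        ≈⟨ ∑-first m _ ⟩
      binom N (suc m) ⊗ (1# ⊗ powR R y (suc m))
        ⊕ ∑ m (λ j → binom N (m ∸ j) ⊗ ((x ⊗ powR R x j) ⊗ powR R y (m ∸ j)))
        ≈⟨ +-cong (*-congˡ (*-identityˡ _)) (∑-cong m (λ j _ → pull-x _ _ _)) ⟩
      binom N (suc m) ⊗ powR R y (suc m)
        ⊕ ∑ m (λ j → x ⊗ (binom N (m ∸ j) ⊗ (powR R x j ⊗ powR R y (m ∸ j))))
        ≈⟨ +-congˡ (∑-*ˡ m x _) ⟩
      binom N (suc m) ⊗ powR R y (suc m) ⊕ x ⊗ T N m ∎
      where
      pull-x : ∀ b u v → b ⊗ ((x ⊗ u) ⊗ v) ≈ x ⊗ (b ⊗ (u ⊗ v))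
      pull-x b u v = trans (*-congˡ (*-assoc x u v)) (x∙yz≈y∙xz b x _)

    pascal-term : ∀ N k j →
      binom (suc N) (suc k) ⊗ (powR R x j ⊗ powR R y (suc k))
        ≈ binom N (suc k) ⊗ (powR R x j ⊗ powR R y (suc k))
          ⊕ y ⊗ (binom N k ⊗ (powR R x j ⊗ powR R y k))
    pascal-term N k j = begin
      binom (suc N) (suc k) ⊗ u
        ≈⟨ *-congʳ (reflexive (P.cong (natR R) (P.sym (nCk+nC[k+1]≡[n+1]C[k+1] N k)))) ⟩
      natR R (N C k + N C suc k) ⊗ u
        ≈⟨ *-congʳ (natR-+ (N C k) (N C suc k)) ⟩
      (binom N k ⊕ binom N (suc k)) ⊗ u
        ≈⟨ trans (distribʳ u _ _) (+-comm _ _) ⟩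
      binom N (suc k) ⊗ u ⊕ binom N k ⊗ u
        ≈⟨ +-congˡ (trans (*-congˡ (x∙yz≈y∙xz _ y _)) (x∙yz≈y∙xz _ y _)) ⟩
      binom N (suc k) ⊗ u ⊕ y ⊗ (binom N k ⊗ (powR R x j ⊗ powR R y k)) ∎
      where u = powR R x j ⊗ powR R y (suc k)

    T-pascal : ∀ N m → T (suc N) (suc m) ≈ T N (suc m) ⊕ y ⊗ T N m
    T-pascal N m = begin
      ∑ m f₁ ⊕ f₁ (suc m)                             ≈⟨ +-cong (∑-cong m pascal) last-term ⟩
      ∑ m (λ j → f₀ j ⊕ y ⊗ g j) ⊕ f₀ (suc m)         ≈⟨ +-congʳ (trans (∑-+ m f₀ _) (+-congˡ (∑-*ˡ m y g))) ⟩
      (∑ m f₀ ⊕ y ⊗ T N m) ⊕ f₀ (suc m)               ≈⟨ xy∙z≈xz∙y _ _ _ ⟩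
      T N (suc m) ⊕ y ⊗ T N m                         ∎
      where
      f₁ f₀ g : ℕ → Carrier
      f₁ j = binom (suc N) (suc m ∸ j) ⊗ (powR R x j ⊗ powR R y (suc m ∸ j))
      f₀ j = binom N (suc m ∸ j) ⊗ (powR R x j ⊗ powR R y (suc m ∸ j))
      g  j = binom N (m ∸ j) ⊗ (powR R x j ⊗ powR R y (m ∸ j))

      pascal : ∀ j → j ≤ m → f₁ j ≈ f₀ j ⊕ y ⊗ g j
      pascal j j≤m rewrite +-∸-assoc 1 j≤m = pascal-term N (m ∸ j) j

      -- the top term has coefficient C(N+1, 0) = C(N, 0) = 1
      last-term : f₁ (suc m) ≈ f₀ (suc m)
      last-term rewrite n∸n≡0 m = refl

    T-step : ∀ N m → T (suc N) (suc m) ≈ binom N (suc m) ⊗ powR R y (suc m) ⊕ T N m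
    T-step N m = begin
      T (suc N) (suc m)                ≈⟨ T-pascal N m ⟩
      T N (suc m) ⊕ y ⊗ T N m          ≈⟨ +-congʳ (T-first N m) ⟩
      (top ⊕ x ⊗ T N m) ⊕ y ⊗ T N m    ≈⟨ +-assoc _ _ _ ⟩
      top ⊕ (x ⊗ T N m ⊕ y ⊗ T N m)    ≈⟨ +-congˡ (sym (distribʳ _ x y)) ⟩
      top ⊕ (x ⊕ y) ⊗ T N m            ≈⟨ +-congˡ (trans (*-congʳ x+y≈1) (*-identityˡ _)) ⟩
      top ⊕ T N m                      ∎
      where top = binom N (suc m) ⊗ powR R y (suc m)

    T-closed : ∀ a m → T (suc (a + m)) m ≈ ∑ m (λ i → binom (a + i) i ⊗ powR R y i)
    T-closed a zero    = *-congˡ (*-identityˡ _)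
    T-closed a (suc m) rewrite +-suc a m = begin
      T (suc (suc (a + m))) (suc m)    ≈⟨ T-step (suc (a + m)) m ⟩
      top ⊕ T (suc (a + m)) m          ≈⟨ +-congˡ (T-closed a m) ⟩
      top ⊕ ∑ m (λ i → binom (a + i) i ⊗ powR R y i) ≈⟨ +-comm _ _ ⟩
      ∑ m (λ i → binom (a + i) i ⊗ powR R y i) ⊕ top ∎
      where top = binom (suc (a + m)) (suc m) ⊗ powR R y (suc m)

corollary2 : {c ℓ : Level} (R : CommutativeRing c ℓ) (n : ℕ) (x : CommutativeRing.Carrier R) →
    let module R = CommutativeRing R in
    (sumR R n (λ j → natR R ((3 * n ∸ j) C (2 * n)) R.* powR R (R.1# R.- x) (n ∸ j))
      R.≈ sumR R n (λ j → natR R ((3 * n + 1) C (n ∸ j)) R.* (powR R x j R.* powR R (R.1# R.- x) (n ∸ j))))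
    ×
    (sumR R (2 * n) (λ j → natR R ((3 * n ∸ j) C n) R.* powR R (R.1# R.- x) (2 * n ∸ j))
      R.≈ sumR R (2 * n) (λ k → natR R ((3 * n + 1) C (n + 1 + k)) R.* (powR R x k R.* powR R (R.1# R.- x) (2 * n ∸ k))))
corollary2 R n x = first , second
  where
  open CommutativeRing R renaming (_+_ to _⊕_; _*_ to _⊗_)
  open Sums R using (∑; ∑-cong)
  open AbelianGroupProperties +-abelianGroup using (xyx⁻¹≈y)

  y : Carrier
  y = 1# - x

  x+y≈1 : x ⊕ y ≈ 1#
  x+y≈1 = trans (sym (+-assoc x 1# (- x))) (xyx⁻¹≈y x 1#)

  open BinomialSums R using (reindex; T-closed)

  -- Both parts rewrite 3n + 1 to suc (3n); since 3n = n + 2n holds definitionally,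
  -- only the first part needs to rewrite 3n to 2n + n.
  first : ∑ n (λ j → natR R ((3 * n ∸ j) C (2 * n)) ⊗ powR R y (n ∸ j))
        ≈ ∑ n (λ j → natR R ((3 * n + 1) C (n ∸ j)) ⊗ (powR R x j ⊗ powR R y (n ∸ j)))
  first rewrite ℕₚ.+-comm (3 * n) 1 | ℕₚ.+-comm n (2 * n) =
    trans (reindex (2 * n) n y) (sym (T-closed x+y≈1 (2 * n) n))

  second : ∑ (2 * n) (λ j → natR R ((3 * n ∸ j) C n) ⊗ powR R y (2 * n ∸ j))
         ≈ ∑ (2 * n) (λ k → natR R ((3 * n + 1) C (n + 1 + k)) ⊗ (powR R x k ⊗ powR R y (2 * n ∸ k)))
  second rewrite ℕₚ.+-comm (3 * n) 1 =
    trans (reindex n (2 * n) y) (trans (sym (T-closed x+y≈1 n (2 * n))) (∑-cong (2 * n) λ k k≤2n →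
      *-congʳ (reflexive (P.cong (natR R) (complement k k≤2n)))))
    where
    complement : ∀ k → k ≤ 2 * n → suc (3 * n) C (2 * n ∸ k) ≡ suc (3 * n) C (n + 1 + k)
    complement k k≤2n =
      P.trans (choose-symmetric-∸ (suc n) k≤2n) (P.cong (λ i → suc (3 * n) C (i + k)) (ℕₚ.+-comm 1 n))
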